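{- For the negation of the shifted equality function, $S(\neg\mathrm{SEQ}_n)=2^{\Theta(n)}$, $P(\neg\mathrm{SEQ}_n)=2^{\Omega(\sqrt n)}$, and $C(\neg\mathrm{SEQ}_n)=O(n^2)$.
   Context: $\mathrm{SEQ}_n:\{0,1\}^n\times\{0,1\}^n\times[n]\to\{0,1\}$, $\mathrm{SEQ}_n(x,y,i)=1$ iff $x_j=y_{t_j}$ for all $j\in[n]$ where $t_j\in[n]$, $t_j\equiv j+i-1\pmod n$; it is viewed as a Boolean function on $N=2n+\log n$ bits, and $\neg\mathrm{SEQ}_n=1-\mathrm{SEQ}_n$. For $f$ on $N$ variables and $A\subseteq[N]$, $f_A$ is the matrix with rows indexed by assignments to $A$, columns by assignments to the complement, entry the value of $f$; $\mathsf{nrows}(f_A)$ its number of distinct rows; $S(f)=\max_k\min_{|A|=k}\mathsf{nrows}(f_A)$. A matrix $M\in\mathbb{N}^{a\times b}$ is a rectangle if $M(i,j)=g_ih_j$ with $g\in\{0,1\}^a$, $h\in\mathbb{N}^b$; $g$ is an $A$-rectangle if $g_A$ is a rectangle. $C(f,A)$ is the least $r$ such that $f$ is the OR of $r$ Boolean $A$-rectangles, $C(f)=\max_k\min_{|A|=k}C(f,A)$. $P^+(g,A)$ is the least $r$ such that $g$ is an integer sum of $r$ pairwise orthogonal (product identically zero) $A$-rectangles; $P(f)=\max_k\min_{|A|=k}(P^+(f,A)+P^+(\neg f,A))$. -}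

module Defs where

open import Data.Bool using (Bool; true; false; not; _∧_; _∨_; if_then_else_)
open import Data.Nat using (ℕ; zero; suc; _+_; _*_; _^_; _≤_; _⊔_; _⊓_; _≡ᵇ_)
open import Data.Nat.DivMod using (_%_; m%n<n)
open import Data.Nat.Properties using (m^n≢0)
open import Data.Fin using (Fin; zero; suc; toℕ; fromℕ<; _↑ˡ_; _↑ʳ_)
open import Data.Fin.Subset using (Subset; ∣_∣)
open import Data.Vec using (Vec; lookup; tabulate)
open import Data.List using (List; []; _∷_; length; map; concatMap; filterᵇ; deduplicateᵇ; foldr; upTo)
open import Data.Product using (Σ; _×_; _,_)
open import Relation.Binary.PropositionalEquality using (_≡_; _≢_)

Assignment : ℕ → Set
Assignment N = Fin N → Bool

BoolFun : ℕ → Set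
BoolFun N = Assignment N → Bool

b2n : Bool → ℕ
b2n true  = 1
b2n false = 0

_==_ : Bool → Bool → Bool
true  == b = b
false == b = not b

allF : ∀ {r} → (Fin r → Bool) → Bool
allF {zero}  p = true
allF {suc r} p = p zero ∧ allF (λ i → p (suc i))

anyF : ∀ {r} → (Fin r → Bool) → Bool
anyF {zero}  p = false
anyF {suc r} p = p zero ∨ anyF (λ i → p (suc i))

sumF : ∀ {r} → (Fin r → ℕ) → ℕ
sumF {zero}  h = 0
sumF {suc r} h = h zero + sumF (λ i → h (suc i))

-- SEQ_n for n = 2 ^ m, on N = 2n + log n = n + n + m variables.
-- Variable layout: x_1..x_n, then y_1..y_n, then the m bits of i.
-- The index i ∈ [n] is encoded as i = 1 + (binary value of the m bits),
-- bit k (0-based) having weight 2^k.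

NVars : ℕ → ℕ
NVars m = (2 ^ m + 2 ^ m) + m

binVal : ∀ {m} → (Fin m → Bool) → ℕ
binVal {zero}  b = 0
binVal {suc m} b = b2n (b zero) + 2 * binVal (λ k → b (suc k))

-- With 0-based indices j' = j - 1, t_j - 1 = (j' + (i - 1)) mod n.
SEQ : (m : ℕ) → BoolFun (NVars m)
SEQ m σ = allF (λ j → x j == y (shift j))
  where
  n : ℕ
  n = 2 ^ m
  x : Fin n → Bool
  x j = σ ((j ↑ˡ n) ↑ˡ m)
  y : Fin n → Bool
  y j = σ ((n ↑ʳ j) ↑ˡ m)
  ibits : Fin m → Bool
  ibits k = σ ((n + n) ↑ʳ k)
  shift : Fin n → Fin n
  shift j = fromℕ< (m%n<n (toℕ j + binVal ibits) n {{m^n≢0 2 m}})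

negSEQ : (m : ℕ) → BoolFun (NVars m)
negSEQ m σ = not (SEQ m σ)

-- Partitions A ⊆ [N] (a Subset N; 'true' = in A).
-- An assignment to A (resp. to the complement) is represented by a full
-- assignment of which only the values on A (resp. complement) are read:
-- merge A α β takes α on A and β off A.  So f_A(α, β) = f (merge A α β).

merge : ∀ {N} → Subset N → Assignment N → Assignment N → Assignment N
merge A α β v = if lookup A v then α v else β v

extend : ∀ {N} → Bool → Assignment N → Assignment (suc N)
extend b σ zero    = b
extend b σ (suc i) = σ i

allAssign : ∀ N → List (Assignment N)
allAssign zero    = (λ ()) ∷ []
allAssign (suc N) = concatMap (λ σ → extend false σ ∷ extend true σ ∷ []) (allAssign N)

allL : ∀ {X : Set} → (X → Bool) → List X → Bool
allL p []       = true
allL p (x ∷ xs) = p x ∧ allL p xs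

allSubsets : ∀ N → List (Subset N)
allSubsets N = map tabulate (allAssign N)

rowEq : ∀ {N} → BoolFun N → Subset N → Assignment N → Assignment N → Bool
rowEq {N} f A α α' = allL (λ β → f (merge A α β) == f (merge A α' β)) (allAssign N)

nrows : ∀ {N} → BoolFun N → Subset N → ℕ
nrows {N} f A = length (deduplicateᵇ (rowEq f A) (allAssign N))

minL : List ℕ → ℕ
minL []       = 0
minL (x ∷ xs) = foldr _⊓_ x xs

maxL : List ℕ → ℕ
maxL = foldr _⊔_ 0

S : ∀ {N} → BoolFun N → ℕ
S {N} f = maxL (map (λ k → minL (map (nrows f) (filterᵇ (λ A → ∣ A ∣ ≡ᵇ k) (allSubsets N))))
                    (upTo (suc N)))

-- Rectangles.  g : {0,1}^N → ℕ is an A-rectangle iff g_A(α,β) = u(α) h(β)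
-- with u ∈ {0,1}^(rows), h ∈ ℕ^(columns); u depends only on the A-part,
-- h only on the complement part.

IsRectangle : ∀ {N} → Subset N → (Assignment N → ℕ) → Set
IsRectangle {N} A g =
  Σ (Assignment N → Bool) λ u → Σ (Assignment N → ℕ) λ h →
    (∀ α β → u (merge A α β) ≡ u α) ×
    (∀ α β → h (merge A α β) ≡ h β) ×
    (∀ α β → g (merge A α β) ≡ b2n (u α) * h β)

IsORofRects : ∀ {N} → BoolFun N → Subset N → ℕ → Set
IsORofRects {N} f A r =
  Σ (Fin r → BoolFun N) λ gs →
    (∀ i → IsRectangle A (λ σ → b2n (gs i σ))) ×
    (∀ σ → f σ ≡ anyF (λ i → gs i σ))

IsOrthSumOfRects : ∀ {N} → (Assignment N → ℕ) → Subset N → ℕ → Set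
IsOrthSumOfRects {N} g A r =
  Σ (Fin r → Assignment N → ℕ) λ hs →
    (∀ i → IsRectangle A (hs i)) ×
    (∀ i j → i ≢ j → ∀ σ → hs i σ * hs j σ ≡ 0) ×
    (∀ σ → g σ ≡ sumF (λ i → hs i σ))

-- Achievability predicates: C(f,A) is the least r with CAch f A r;
-- P^+(f,A) + P^+(¬f,A) is the least r with PAch f A r.
CAch : ∀ {N} → BoolFun N → Subset N → ℕ → Set
CAch f A r = IsORofRects f A r

PAch : ∀ {N} → BoolFun N → Subset N → ℕ → Set
PAch f A r = Σ ℕ λ r₁ → Σ ℕ λ r₂ → (r₁ + r₂ ≡ r) ×
  IsOrthSumOfRects (λ σ → b2n (f σ)) A r₁ ×
  IsOrthSumOfRects (λ σ → b2n (not (f σ))) A r₂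

-- For cost(A) := least r with Ach A r, and V := max_k min_{|A|=k} cost(A):
--   MaxMinAtMost Ach B      ⇔  V ≤ B
--   MaxMinSatisfies Ach Q   ⇔  Q V      (for upward-closed Q)
MaxMinAtMost : ∀ {N} → (Subset N → ℕ → Set) → ℕ → Set
MaxMinAtMost {N} Ach B =
  ∀ k → k ≤ N → Σ (Subset N) λ A → (∣ A ∣ ≡ k) × (Σ ℕ λ r → (r ≤ B) × Ach A r)

MaxMinSatisfies : ∀ {N} → (Subset N → ℕ → Set) → (ℕ → Set) → Set
MaxMinSatisfies {N} Ach Q =
  Σ ℕ λ k → (k ≤ N) × (∀ A → ∣ A ∣ ≡ k → ∀ r → Ach A r → Q r)

-- Write n = 2^m = 16 t.  For |A| = n, call the pair (x_j, y_(j+i)) split by the shift i when exactly one of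
-- its variables lies in A.  Summed over all n shifts, the number of split pairs is a (n - b) + (n - a) b, where
-- a and b count the x- and y-variables in A; since a + b >= n - m >= n/2 this is at least n t, so some shift i
-- splits t pairs.  Spreading the bits of w < 2^t over those pairs, copying x_j to y_(j+i) and encoding i gives
-- 2^t inputs accepted by SEQ, while combining the A-part of one with the rest of another is rejected.  This
-- fooling set bounds both nrows and the number of rectangles summing to SEQ = not negSEQ below by 2^(n/16);
-- nrows <= 2^N <= 2^(3n) is trivial.  Conversely negSEQ is the OR of the 2 n^2 conjunctions
-- "the shift is i, x_j = c and y_(j+i) = not c", and every conjunction of literals is a rectangle.

module Submission where

open import Defs
open import Data.Bool using (Bool; true; false; not; _∧_; _∨_; if_then_else_; T) renaming (_≟_ to _≟ᵇ_)
open import Data.Bool.Properties using (∧-identityʳ; ∧-zeroʳ; not-involutive; not-injective; T-∧; ⇔→≡)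
open import Data.Nat using (ℕ; zero; suc; _+_; _*_; _^_; _≤_; _<_; _∸_; _⊓_; _≡ᵇ_; ⌊_/2⌋; z≤n; s≤s; NonZero; _≤?_)
open import Data.Nat.Properties
open import Data.Nat.DivMod using (_%_; m%n<n; %-distribˡ-+; m%n%n≡m%n; m<n⇒m%n≡m; [m+n]%n≡m%n)
open import Data.Nat.Tactic.RingSolver using (solve-∀)
open import Data.Fin using (Fin; zero; suc; toℕ; fromℕ<; _↑ˡ_; _↑ʳ_; splitAt; combine; remQuot)
open import Data.Fin.Properties
  using ( injective⇒≤; 2↔Bool; remQuot-combine; toℕ-injective; splitAt-↑ˡ; splitAt-↑ʳ
        ; toℕ<n; toℕ-fromℕ<; fromℕ<-toℕ; fromℕ<-cong)
  renaming (_≟_ to _≟ᶠ_)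
open import Data.Fin.Subset using (Subset; ∣_∣)
open import Data.Vec using ([]; _∷_; lookup)
open import Data.Vec.Properties using (tabulate∘lookup; tabulate-cong)
open import Data.List using (List; []; _∷_; length; deduplicate; tabulate; map; filterᵇ; foldr; concatMap; applyUpTo)
open import Data.List.Properties using (length-deduplicate)
open import Data.List.Membership.Propositional using (_∈_)
open import Data.List.Membership.Propositional.Properties using (∈-map⁺; ∈-filter⁺)
open import Data.List.Relation.Unary.Any using (Any; here; there; index)
import Data.List.Relation.Unary.Any as Any
open import Data.List.Relation.Unary.Any.Properties
  using (deduplicate⁺; lookup-index; concatMap⁺; applyUpTo⁺) renaming (map⁺ to Any-map⁺)
open import Data.List.Relation.Unary.All using (All; []; _∷_)
import Data.List.Relation.Unary.All as All
open import Data.List.Relation.Unary.All.Properties using (all-filter; applyUpTo⁺₂) renaming (map⁺ to All-map⁺)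
open import Data.Product using (Σ; _×_; _,_; proj₁; proj₂)
open import Data.Sum using (_⊎_; inj₁; inj₂; [_,_]′)
open import Data.Empty using (⊥-elim)
open import Function using (_∘_; id; Equivalence; Inverse; _⇔_; mk⇔)
open import Relation.Nullary using (yes; no; contradiction)
open import Relation.Nullary.Decidable.Core using (T?)
open import Relation.Binary using (Rel; Decidable; Symmetric; Transitive)
open import Relation.Binary.PropositionalEquality
  using (_≡_; _≢_; _≗_; refl; sym; trans; cong; cong₂; subst; subst₂; module ≡-Reasoning)

==-refl : ∀ b → (b == b) ≡ true
==-refl true  = refl
==-refl false = refl

==⇒≡ : ∀ {a b} → (a == b) ≡ true → a ≡ b
==⇒≡ {true}  {true}  _ = refl
==⇒≡ {false} {false} _ = refl
==⇒≡ {true}  {false} ()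
==⇒≡ {false} {true}  ()

≡⇒== : ∀ {a b} → a ≡ b → (a == b) ≡ true
≡⇒== {a} refl = ==-refl a

≢⇒==-false : ∀ {a b} → a ≢ b → (a == b) ≡ false
≢⇒==-false {true}  {true}  a≢b = ⊥-elim (a≢b refl)
≢⇒==-false {false} {false} a≢b = ⊥-elim (a≢b refl)
≢⇒==-false {true}  {false} _   = refl
≢⇒==-false {false} {true}  _   = refl

==-false⇒≡not : ∀ {a b} → (a == b) ≡ false → b ≡ not a
==-false⇒≡not {true}  {false} _ = refl
==-false⇒≡not {false} {true}  _ = refl
==-false⇒≡not {true}  {true}  ()
==-false⇒≡not {false} {false} ()

allF⁺ : ∀ {r} (p : Fin r → Bool) → (∀ i → p i ≡ true) → allF p ≡ true
allF⁺ {zero}  p h = refl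
allF⁺ {suc r} p h rewrite h zero = allF⁺ (p ∘ suc) (h ∘ suc)

allF⁻ : ∀ {r} (p : Fin r → Bool) → allF p ≡ true → ∀ i → p i ≡ true
allF⁻ {suc r} p h i with p zero in eq
allF⁻ {suc r} p h zero    | true = eq
allF⁻ {suc r} p h (suc i) | true = allF⁻ (p ∘ suc) h i

allF-false⁺ : ∀ {r} (p : Fin r → Bool) (i : Fin r) → p i ≡ false → allF p ≡ false
allF-false⁺ {suc r} p zero    h rewrite h = refl
allF-false⁺ {suc r} p (suc i) h with p zero
... | true  = allF-false⁺ (p ∘ suc) i h
... | false = refl

allF-false⁻ : ∀ {r} (p : Fin r → Bool) → allF p ≡ false → Σ (Fin r) λ i → p i ≡ false
allF-false⁻ {suc r} p h with p zero in eq
... | false = zero , eq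
... | true with allF-false⁻ (p ∘ suc) h
...   | i , q = suc i , q

allF-cong : ∀ {r} {p q : Fin r → Bool} → p ≗ q → allF p ≡ allF q
allF-cong {zero}  p≗q = refl
allF-cong {suc r} p≗q = cong₂ _∧_ (p≗q zero) (allF-cong (p≗q ∘ suc))

anyF⁺ : ∀ {r} (p : Fin r → Bool) (i : Fin r) → p i ≡ true → anyF p ≡ true
anyF⁺ {suc r} p zero    h rewrite h = refl
anyF⁺ {suc r} p (suc i) h with p zero
... | true  = refl
... | false = anyF⁺ (p ∘ suc) i h

anyF⁻ : ∀ {r} (p : Fin r → Bool) → anyF p ≡ true → Σ (Fin r) λ i → p i ≡ true
anyF⁻ {suc r} p h with p zero in eq
... | true  = zero , eq
... | false with anyF⁻ (p ∘ suc) h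
...   | i , q = suc i , q

sumF-cong : ∀ {r} {p q : Fin r → ℕ} → p ≗ q → sumF p ≡ sumF q
sumF-cong {zero}  p≗q = refl
sumF-cong {suc r} p≗q = cong₂ _+_ (p≗q zero) (sumF-cong (p≗q ∘ suc))

≤-sumF : ∀ {r} (p : Fin r → ℕ) (i : Fin r) → p i ≤ sumF p
≤-sumF {suc r} p zero    = m≤m+n _ _
≤-sumF {suc r} p (suc i) = ≤-trans (≤-sumF (p ∘ suc) i) (m≤n+m _ _)

sumF-pos⇒pos : ∀ {r} (p : Fin r → ℕ) → 0 < sumF p → Σ (Fin r) λ i → 0 < p i
sumF-pos⇒pos {suc r} p h with p zero in eq
... | suc _ = zero , subst (0 <_) (sym eq) (s≤s z≤n)
... | zero with sumF-pos⇒pos (p ∘ suc) h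
...   | i , q = suc i , q

sumF-distrib-+ : ∀ {r} (p q : Fin r → ℕ) → sumF (λ i → p i + q i) ≡ sumF p + sumF q
sumF-distrib-+ {zero}  p q = refl
sumF-distrib-+ {suc r} p q
  rewrite sumF-distrib-+ (p ∘ suc) (q ∘ suc) = swap (p zero) (q zero) (sumF (p ∘ suc)) (sumF (q ∘ suc))
  where
  swap : ∀ a b c d → a + b + (c + d) ≡ a + c + (b + d)
  swap = solve-∀

sumF-↑ : ∀ a b (h : Fin (a + b) → ℕ) → sumF h ≡ sumF (λ i → h (i ↑ˡ b)) + sumF (λ i → h (a ↑ʳ i))
sumF-↑ zero    b h = refl
sumF-↑ (suc a) b h = trans (cong (h zero +_) (sumF-↑ a b (h ∘ suc))) (sym (+-assoc (h zero) _ _))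

count : ∀ {r} → (Fin r → Bool) → ℕ
count p = sumF (b2n ∘ p)

count≤ : ∀ {r} (p : Fin r → Bool) → count p ≤ r
count≤ {zero}  p = z≤n
count≤ {suc r} p with p zero
... | true  = s≤s (count≤ (p ∘ suc))
... | false = m≤n⇒m≤1+n (count≤ (p ∘ suc))

count+count-not : ∀ {r} (p : Fin r → Bool) → count p + count (not ∘ p) ≡ r
count+count-not {zero}  p = refl
count+count-not {suc r} p with p zero
... | true  = cong suc (count+count-not (p ∘ suc))
... | false = trans (+-suc _ _) (cong suc (count+count-not (p ∘ suc)))

sumF-by-cases : ∀ {r} (d : Fin r → Bool) (K : Bool → ℕ) →
  sumF (K ∘ d) ≡ count d * K true + count (not ∘ d) * K false
sumF-by-cases {zero}  d K = refl
sumF-by-cases {suc r} d K with d zero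
... | true  rewrite sumF-by-cases (d ∘ suc) K = shuffle (K true) (K false) (count (d ∘ suc)) (count (not ∘ d ∘ suc))
  where
  shuffle : ∀ P Q x y → P + (x * P + y * Q) ≡ (1 + x) * P + y * Q
  shuffle = solve-∀
... | false rewrite sumF-by-cases (d ∘ suc) K = shuffle (K true) (K false) (count (d ∘ suc)) (count (not ∘ d ∘ suc))
  where
  shuffle : ∀ P Q x y → Q + (x * P + y * Q) ≡ x * P + (1 + y) * Q
  shuffle = solve-∀

∣∣≡count : ∀ {N} (A : Subset N) → ∣ A ∣ ≡ count (lookup A)
∣∣≡count []          = refl
∣∣≡count (true ∷ A)  = cong suc (∣∣≡count A)
∣∣≡count (false ∷ A) = ∣∣≡count A

∧-≡true⁻ : ∀ {a b} → (a ∧ b) ≡ true → a ≡ true × b ≡ true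
∧-≡true⁻ {true} {true} _ = refl , refl

∧-interchange : ∀ a b c d → (a ∧ b) ∧ (c ∧ d) ≡ (a ∧ c) ∧ (b ∧ d)
∧-interchange true  b true  d = refl
∧-interchange true  b false d = ∧-zeroʳ b
∧-interchange false b c     d = refl

b2n-∧ : ∀ a b → b2n (a ∧ b) ≡ b2n a * b2n b
b2n-∧ true  b = sym (+-identityʳ (b2n b))
b2n-∧ false b = refl

allL-cong : ∀ {X : Set} {p q : X → Bool} → p ≗ q → ∀ xs → allL p xs ≡ allL q xs
allL-cong p≗q []       = refl
allL-cong p≗q (x ∷ xs) = cong₂ _∧_ (p≗q x) (allL-cong p≗q xs)

allL-∧ : ∀ {X : Set} (p q : X → Bool) xs → allL (λ x → p x ∧ q x) xs ≡ allL p xs ∧ allL q xs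
allL-∧ p q []       = refl
allL-∧ p q (x ∷ xs) = trans (cong ((p x ∧ q x) ∧_) (allL-∧ p q xs)) (∧-interchange (p x) (q x) (allL p xs) (allL q xs))

allL-tabulate : ∀ {X : Set} {r} (p : X → Bool) (g : Fin r → X) → allL p (tabulate g) ≡ allF (p ∘ g)
allL-tabulate {r = zero}  p g = refl
allL-tabulate {r = suc r} p g = cong (p (g zero) ∧_) (allL-tabulate p (g ∘ suc))

sumTo : ℕ → (ℕ → ℕ) → ℕ
sumTo zero    G = 0
sumTo (suc n) G = G 0 + sumTo n (G ∘ suc)

sumF-toℕ : ∀ n (G : ℕ → ℕ) → sumF {n} (G ∘ toℕ) ≡ sumTo n G
sumF-toℕ zero    G = refl
sumF-toℕ (suc n) G = cong (G 0 +_) (sumF-toℕ n (G ∘ suc))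

sumTo-suc : ∀ n (G : ℕ → ℕ) → sumTo (suc n) G ≡ sumTo n G + G n
sumTo-suc zero    G = +-comm (G 0) 0
sumTo-suc (suc n) G rewrite sumTo-suc n (G ∘ suc) = sym (+-assoc (G 0) _ _)

sumTo-sumF : ∀ n {r} (F : ℕ → Fin r → ℕ) → sumTo n (λ i → sumF (F i)) ≡ sumF (λ j → sumTo n (λ i → F i j))
sumTo-sumF zero    {r} F = sym (sumF-zero r)
  where
  sumF-zero : ∀ r → sumF {r} (λ _ → 0) ≡ 0
  sumF-zero zero    = refl
  sumF-zero (suc r) = sumF-zero r
sumTo-sumF (suc n) F rewrite sumTo-sumF n (F ∘ suc) = sym (sumF-distrib-+ (F 0) _)

Periodic : ℕ → (ℕ → ℕ) → Set
Periodic n G = ∀ k → G (n + k) ≡ G k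

sumTo-periodic-suc : ∀ n (G : ℕ → ℕ) → Periodic n G → sumTo n (G ∘ suc) ≡ sumTo n G
sumTo-periodic-suc zero    G per = refl
sumTo-periodic-suc (suc n) G per = begin
  sumTo (suc n) (G ∘ suc)      ≡⟨ sumTo-suc n (G ∘ suc) ⟩
  sumTo n (G ∘ suc) + G (suc n) ≡⟨ cong (sumTo n (G ∘ suc) +_) (trans (cong G (sym (+-identityʳ (suc n)))) (per 0)) ⟩
  sumTo n (G ∘ suc) + G 0       ≡⟨ +-comm _ (G 0) ⟩
  sumTo (suc n) G               ∎
  where open ≡-Reasoning

sumTo-periodic-shift : ∀ n (G : ℕ → ℕ) → Periodic n G → ∀ j → sumTo n (λ i → G (j + i)) ≡ sumTo n G
sumTo-periodic-shift n G per zero    = refl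
sumTo-periodic-shift n G per (suc j) =
  trans (sumTo-periodic-shift n (G ∘ suc) per-suc j) (sumTo-periodic-suc n G per)
  where
  per-suc : Periodic n (G ∘ suc)
  per-suc k = trans (cong G (sym (+-suc n k))) (per (suc k))

sumTo-pigeonhole : ∀ n (G : ℕ → ℕ) t → 0 < n → n * t ≤ sumTo n G → Σ ℕ λ i → i < n × t ≤ G i
sumTo-pigeonhole (suc n) G t _ h with t ≤? G 0
... | yes t≤G0 = 0 , s≤s z≤n , t≤G0
sumTo-pigeonhole (suc zero) G t _ h | no t≰G0 =
  ⊥-elim (t≰G0 (subst₂ _≤_ (+-identityʳ t) (+-identityʳ (G 0)) h))
sumTo-pigeonhole (suc (suc n)) G t _ h | no t≰G0 with sumTo-pigeonhole (suc n) (G ∘ suc) t (s≤s z≤n) tail-bound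
  where
  tail-bound : suc n * t ≤ sumTo (suc n) (G ∘ suc)
  tail-bound = +-cancelˡ-≤ t _ _ (≤-trans h (+-monoˡ-≤ _ (<⇒≤ (≰⇒> t≰G0))))
... | i , i<n , t≤G = suc i , s≤s i<n , t≤G

odd : ℕ → Bool
odd zero          = false
odd (suc zero)    = true
odd (suc (suc x)) = odd x

bit : ℕ → ℕ → Bool
bit x zero    = odd x
bit x (suc k) = bit ⌊ x /2⌋ k

b2n+2*-suc : ∀ c y → b2n c + 2 * suc y ≡ suc (suc (b2n c + 2 * y))
b2n+2*-suc c y = trans (cong (b2n c +_) (*-suc 2 y)) (trans (+-suc (b2n c) _) (cong suc (+-suc (b2n c) _)))

odd+⌊/2⌋ : ∀ x → b2n (odd x) + 2 * ⌊ x /2⌋ ≡ x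
odd+⌊/2⌋ zero          = refl
odd+⌊/2⌋ (suc zero)    = refl
odd+⌊/2⌋ (suc (suc x)) = trans (b2n+2*-suc (odd x) ⌊ x /2⌋) (cong (λ z → suc (suc z)) (odd+⌊/2⌋ x))

odd-b2n+2* : ∀ c y → odd (b2n c + 2 * y) ≡ c
odd-b2n+2* true  zero    = refl
odd-b2n+2* false zero    = refl
odd-b2n+2* c     (suc y) rewrite b2n+2*-suc c y = odd-b2n+2* c y

⌊b2n+2*/2⌋ : ∀ c y → ⌊ b2n c + 2 * y /2⌋ ≡ y
⌊b2n+2*/2⌋ true  zero    = refl
⌊b2n+2*/2⌋ false zero    = refl
⌊b2n+2*/2⌋ c     (suc y) rewrite b2n+2*-suc c y = cong suc (⌊b2n+2*/2⌋ c y)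

⌊/2⌋-< : ∀ x t → x < 2 * t → ⌊ x /2⌋ < t
⌊/2⌋-< x t x<2t = *-cancelˡ-< 2 _ _ (≤-<-trans (m≤n+m _ (b2n (odd x))) (subst (_< 2 * t) (sym (odd+⌊/2⌋ x)) x<2t))

binVal-cong : ∀ {m} {b c : Fin m → Bool} → b ≗ c → binVal b ≡ binVal c
binVal-cong {zero}  b≗c = refl
binVal-cong {suc m} b≗c = cong₂ (λ u v → b2n u + 2 * v) (b≗c zero) (binVal-cong (b≗c ∘ suc))

binVal-bit : ∀ m x → x < 2 ^ m → binVal {m} (bit x ∘ toℕ) ≡ x
binVal-bit zero    zero    _ = refl
binVal-bit zero    (suc x) (s≤s ())
binVal-bit (suc m) x x<2^m =
  trans (cong (λ v → b2n (odd x) + 2 * v) (binVal-bit m ⌊ x /2⌋ (⌊/2⌋-< x (2 ^ m) x<2^m))) (odd+⌊/2⌋ x)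

bit-binVal : ∀ {m} (b : Fin m → Bool) (k : Fin m) → bit (binVal b) (toℕ k) ≡ b k
bit-binVal {suc m} b zero    = odd-b2n+2* (b zero) (binVal (b ∘ suc))
bit-binVal {suc m} b (suc k) =
  trans (cong (λ z → bit z (toℕ k)) (⌊b2n+2*/2⌋ (b zero) (binVal (b ∘ suc)))) (bit-binVal (b ∘ suc) k)

binVal< : ∀ {m} (b : Fin m → Bool) → binVal b < 2 ^ m
binVal< {zero}  b = s≤s z≤n
binVal< {suc m} b = begin-strict
  b2n (b zero) + 2 * v ≤⟨ +-monoˡ-≤ _ (b2n≤1 (b zero)) ⟩
  1 + 2 * v            <⟨ n<1+n _ ⟩
  2 + 2 * v            ≡⟨ sym (*-suc 2 v) ⟩
  2 * suc v            ≤⟨ *-monoʳ-≤ 2 (binVal< (b ∘ suc)) ⟩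
  2 * 2 ^ m            ∎
  where
  open ≤-Reasoning
  v : ℕ
  v = binVal (b ∘ suc)
  b2n≤1 : ∀ c → b2n c ≤ 1
  b2n≤1 true  = ≤-refl
  b2n≤1 false = z≤n

bit-distinct : ∀ t x y → x < 2 ^ t → y < 2 ^ t → x ≢ y → Σ ℕ λ l → l < t × bit x l ≢ bit y l
bit-distinct zero    zero    zero    _          _          x≢y = ⊥-elim (x≢y refl)
bit-distinct zero    (suc x) _       (s≤s ())   _          _
bit-distinct zero    zero    (suc y) _          (s≤s ())   _
bit-distinct (suc t) x       y       x<2^t      y<2^t      x≢y with odd x ≟ᵇ odd y
... | no odd≢ = 0 , s≤s z≤n , odd≢
... | yes odd≡ with bit-distinct t ⌊ x /2⌋ ⌊ y /2⌋ (⌊/2⌋-< x _ x<2^t) (⌊/2⌋-< y _ y<2^t) half≢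
  where
  half≢ : ⌊ x /2⌋ ≢ ⌊ y /2⌋
  half≢ h = x≢y (trans (sym (odd+⌊/2⌋ x)) (trans (cong₂ (λ u v → b2n u + 2 * v) odd≡ h) (odd+⌊/2⌋ y)))
...   | l , l<t , bit≢ = suc l , s≤s l<t , bit≢

2*m≤2^m : ∀ m → 2 * m ≤ 2 ^ m
2*m≤2^m zero          = z≤n
2*m≤2^m (suc zero)    = ≤-refl
2*m≤2^m (suc (suc m)) = begin
  2 * (2 + m)             ≡⟨ *-distribˡ-+ 2 1 (suc m) ⟩
  2 + 2 * suc m           ≤⟨ +-mono-≤ (*-monoʳ-≤ 2 (m^n>0 2 m)) (2*m≤2^m (suc m)) ⟩
  2 * 2 ^ m + 2 * 2 ^ m   ≡⟨ double (2 ^ m) ⟩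
  2 ^ suc (suc m)         ∎
  where
  open ≤-Reasoning
  double : ∀ x → 2 * x + 2 * x ≡ 2 * (2 * x)
  double = solve-∀

covers-half : ∀ {n s ι} → n ≡ s + ι → 2 * ι ≤ n → n ≤ 2 * s
covers-half {s = s} {ι} refl 2ι≤n = +-cancelʳ-≤ (s + ι) _ _ (begin
  s + ι + (s + ι)   ≡⟨ rearrange s ι ⟩
  2 * s + 2 * ι     ≤⟨ +-monoʳ-≤ (2 * s) 2ι≤n ⟩
  2 * s + (s + ι)   ∎)
  where
  open ≤-Reasoning
  rearrange : ∀ s ι → s + ι + (s + ι) ≡ 2 * s + 2 * ι
  rearrange = solve-∀

quarter-square : ∀ {n t x y} → n ≡ 16 * t → n ≤ 4 * x → x ≤ y → n * t ≤ x * y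
quarter-square {t = t} {x} {y} refl 16t≤4x x≤y = begin
  16 * t * t        ≡⟨ square t ⟩
  (4 * t) * (4 * t) ≤⟨ *-mono-≤ 4t≤x 4t≤x ⟩
  x * x             ≤⟨ *-monoʳ-≤ x x≤y ⟩
  x * y             ∎
  where
  open ≤-Reasoning
  square : ∀ t → 16 * t * t ≡ (4 * t) * (4 * t)
  square = solve-∀
  assoc : ∀ t → 16 * t ≡ 4 * (4 * t)
  assoc = solve-∀
  4t≤x : 4 * t ≤ x
  4t≤x = *-cancelˡ-≤ 4 (subst (_≤ 4 * x) (assoc t) 16t≤4x)

twice : ∀ a → 2 * (a + a) ≡ 4 * a
twice = solve-∀

-- The larger of a and b is at least n/4, and it is multiplied by a factor at least as large.
cross-product-bound : ∀ {n t a b a' b'} → n ≡ 16 * t → n ≤ 2 * (a + b) → a ≤ b' → b ≤ a' →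
  n * t ≤ a * b' + a' * b
cross-product-bound {n} {t} {a} {b} {a'} {b'} n≡16t n≤2[a+b] a≤b' b≤a' with ≤-total b a
... | inj₁ b≤a = ≤-trans (quarter-square n≡16t (≤-trans n≤2[a+b] 2[a+b]≤4a) a≤b') (m≤m+n _ _)
  where
  2[a+b]≤4a : 2 * (a + b) ≤ 4 * a
  2[a+b]≤4a = subst (2 * (a + b) ≤_) (twice a) (*-monoʳ-≤ 2 (+-monoʳ-≤ a b≤a))
... | inj₂ a≤b = ≤-trans
  (subst (n * t ≤_) (*-comm b a') (quarter-square n≡16t (≤-trans n≤2[a+b] 2[a+b]≤4b) b≤a')) (m≤n+m _ _)
  where
  2[a+b]≤4b : 2 * (a + b) ≤ 4 * b
  2[a+b]≤4b = subst (2 * (a + b) ≤_) (twice b) (*-monoʳ-≤ 2 (+-monoˡ-≤ b a≤b))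

merge-idem : ∀ {N} (A : Subset N) α → merge A α α ≗ α
merge-idem A α v with lookup A v
... | true  = refl
... | false = refl

merge-cong : ∀ {N} (A : Subset N) {α α' β β'} → α ≗ α' → β ≗ β' → merge A α β ≗ merge A α' β'
merge-cong A α≗α' β≗β' v with lookup A v
... | true  = α≗α' v
... | false = β≗β' v

∈allAssign : ∀ N (σ : Assignment N) → Any (σ ≗_) (allAssign N)
∈allAssign zero    σ = here (λ ())
∈allAssign (suc N) σ = concatMap⁺ _ (Any.map extend-σ₀ (∈allAssign N (σ ∘ suc)))
  where
  extend-σ₀ : ∀ {τ} → σ ∘ suc ≗ τ → Any (σ ≗_) (extend false τ ∷ extend true τ ∷ [])
  extend-σ₀ {τ} σ≗τ with σ zero in eq
  ... | false = here λ { zero → eq ; (suc v) → σ≗τ v }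
  ... | true  = there (here λ { zero → eq ; (suc v) → σ≗τ v })

∃-subset-of-size : ∀ {N k} → k ≤ N → Σ (Subset N) λ A → ∣ A ∣ ≡ k
∃-subset-of-size {zero}  z≤n = [] , refl
∃-subset-of-size {suc N} {zero} z≤n with ∃-subset-of-size {N} z≤n
... | A , ∣A∣≡0 = false ∷ A , ∣A∣≡0
∃-subset-of-size {suc N} {suc k} (s≤s k≤N) with ∃-subset-of-size k≤N
... | A , ∣A∣≡k = true ∷ A , cong suc ∣A∣≡k

∈allSubsets : ∀ {N} (A : Subset N) → A ∈ allSubsets N
∈allSubsets {N} A =
  Any-map⁺ (Any.map (λ A≗τ → trans (sym (tabulate∘lookup A)) (tabulate-cong A≗τ)) (∈allAssign N (lookup A)))

length-allAssign : ∀ N → length (allAssign N) ≡ 2 ^ N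
length-allAssign zero    = refl
length-allAssign (suc N) = trans (length-doubled (allAssign N)) (cong (2 *_) (length-allAssign N))
  where
  length-doubled : ∀ (σs : List (Assignment N)) →
    length (concatMap (λ σ → extend false σ ∷ extend true σ ∷ []) σs) ≡ 2 * length σs
  length-doubled []       = refl
  length-doubled (σ ∷ σs) = trans (cong (λ l → suc (suc l)) (length-doubled σs)) (sym (*-suc 2 (length σs)))

T-allL : ∀ {X : Set} (p : X → Bool) xs → T (allL p xs) ⇔ All (T ∘ p) xs
T-allL p []       = mk⇔ (λ _ → []) (λ _ → _)
T-allL p (x ∷ xs) = mk⇔
  (λ h → let px , pxs = Equivalence.to T-∧ h in px ∷ Equivalence.to (T-allL p xs) pxs)
  (λ { (px ∷ pxs) → Equivalence.from T-∧ (px , Equivalence.from (T-allL p xs) pxs) })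

T-== : ∀ {a b} → T (a == b) ⇔ a ≡ b
T-== {true}  {true}  = mk⇔ (λ _ → refl) (λ _ → _)
T-== {false} {false} = mk⇔ (λ _ → refl) (λ _ → _)
T-== {true}  {false} = mk⇔ (λ ()) (λ ())
T-== {false} {true}  = mk⇔ (λ ()) (λ ())

≤-length-deduplicate : ∀ {a ℓ} {X : Set a} {R : Rel X ℓ} (R? : Decidable R) → Symmetric R → Transitive R →
  ∀ {K} (xs : List X) (g : Fin K → X) → (∀ w → Any (R (g w)) xs) → (∀ w w' → R (g w) (g w') → w ≡ w') →
  K ≤ length (deduplicate R? xs)
≤-length-deduplicate {R = R} R? R-sym R-trans xs g g∈xs g-inj = injective⇒≤ position-injective
  where
  representative : ∀ w → Any (R (g w)) (deduplicate R? xs)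
  representative w = deduplicate⁺ R? (λ yRx gRx → R-trans gRx (R-sym yRx)) (g∈xs w)
  position : ∀ w → Fin (length (deduplicate R? xs))
  position w = index (representative w)
  position-injective : ∀ {w w'} → position w ≡ position w' → w ≡ w'
  position-injective {w} {w'} eq = g-inj w w' (R-trans (lookup-index (representative w))
    (R-sym (subst (λ q → R (g w') (Data.List.lookup (deduplicate R? xs) q)) (sym eq) (lookup-index (representative w')))))

-- nrows compares rows only on the enumerated columns allAssign N, which contain each column up to ≗.
Extensional : ∀ {N} → BoolFun N → Set
Extensional f = ∀ {σ τ} → σ ≗ τ → f σ ≡ f τ

module Rows {N} (f : BoolFun N) (f-ext : Extensional f) (A : Subset N) where

  SameRow : Assignment N → Assignment N → Set
  SameRow α α' = T (rowEq f A α α')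

  SameRow⇔ : ∀ {α α'} → SameRow α α' ⇔ (∀ β → f (merge A α β) ≡ f (merge A α' β))
  SameRow⇔ {α} {α'} = mk⇔ agree
    (λ h → Equivalence.from (T-allL _ (allAssign N)) (All.universal (Equivalence.from T-== ∘ h) _))
    where
    agree : SameRow α α' → ∀ β → f (merge A α β) ≡ f (merge A α' β)
    agree same β =
      let agree-τ , β≗τ = All.lookupAny (Equivalence.to (T-allL _ (allAssign N)) same) (∈allAssign N β)
      in trans (f-ext (merge-cong A (λ _ → refl) β≗τ))
           (trans (Equivalence.to T-== agree-τ) (sym (f-ext (merge-cong A (λ _ → refl) β≗τ))))

  nrows-≥ : ∀ {K} (α : Fin K → Assignment N) →
    (∀ w w' → (∀ β → f (merge A (α w) β) ≡ f (merge A (α w') β)) → w ≡ w') → K ≤ nrows f A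
  nrows-≥ α distinct = ≤-length-deduplicate (λ α α' → T? (rowEq f A α α')) SameRow-sym SameRow-trans
    (allAssign N) α (λ w → Any.map ≗⇒SameRow (∈allAssign N (α w))) (λ w w' → distinct w w' ∘ Equivalence.to SameRow⇔)
    where
    SameRow-sym : ∀ {α α'} → SameRow α α' → SameRow α' α
    SameRow-sym same = Equivalence.from SameRow⇔ (sym ∘ Equivalence.to SameRow⇔ same)
    SameRow-trans : ∀ {α α' α''} → SameRow α α' → SameRow α' α'' → SameRow α α''
    SameRow-trans same same' =
      Equivalence.from SameRow⇔ λ β → trans (Equivalence.to SameRow⇔ same β) (Equivalence.to SameRow⇔ same' β)
    ≗⇒SameRow : ∀ {α α'} → α ≗ α' → SameRow α α'
    ≗⇒SameRow α≗α' = Equivalence.from SameRow⇔ λ β → f-ext (merge-cong A α≗α' (λ _ → refl))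

nrows≤2^N : ∀ {N} (f : BoolFun N) A → nrows f A ≤ 2 ^ N
nrows≤2^N {N} f A = subst (nrows f A ≤_) (length-allAssign N) (length-deduplicate _ (allAssign N))

≤-maxL : ∀ {B xs} → Any (B ≤_) xs → B ≤ maxL xs
≤-maxL {xs = x ∷ xs} (here B≤x)  = ≤-trans B≤x (m≤m⊔n x _)
≤-maxL {xs = x ∷ xs} (there B≤∈) = ≤-trans (≤-maxL B≤∈) (m≤n⊔m x _)

maxL-≤ : ∀ {B xs} → All (_≤ B) xs → maxL xs ≤ B
maxL-≤ []          = z≤n
maxL-≤ (x≤B ∷ xs≤B) = ⊔-lub x≤B (maxL-≤ xs≤B)

≤-minL : ∀ {B x xs} → x ∈ xs → All (B ≤_) xs → B ≤ minL xs
≤-minL {xs = y ∷ ys} _ (B≤y ∷ B≤ys) = ≤-foldr-⊓ B≤y B≤ys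
  where
  ≤-foldr-⊓ : ∀ {B y ys} → B ≤ y → All (B ≤_) ys → B ≤ foldr _⊓_ y ys
  ≤-foldr-⊓ B≤y []            = B≤y
  ≤-foldr-⊓ B≤y (B≤z ∷ B≤zs) = ⊓-glb B≤z (≤-foldr-⊓ B≤y B≤zs)

minL-≤ : ∀ {B xs} → All (_≤ B) xs → minL xs ≤ B
minL-≤ []           = z≤n
minL-≤ {xs = x ∷ xs} (x≤B ∷ xs≤B) = ≤-trans (foldr-⊓-≤ x xs) x≤B
  where
  foldr-⊓-≤ : ∀ x xs → foldr _⊓_ x xs ≤ x
  foldr-⊓-≤ x []       = ≤-refl
  foldr-⊓-≤ x (y ∷ ys) = ≤-trans (m⊓n≤n y _) (foldr-⊓-≤ x ys)

module _ {N} (f : BoolFun N) where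

  ofSize : ℕ → List (Subset N)
  ofSize k = filterᵇ (λ A → ∣ A ∣ ≡ᵇ k) (allSubsets N)

  minRows : ℕ → ℕ
  minRows k = minL (map (nrows f) (ofSize k))

  ≤-S : ∀ {k B} → k ≤ N → (∀ A → ∣ A ∣ ≡ k → B ≤ nrows f A) → B ≤ S f
  ≤-S {k} {B} k≤N bound = ≤-maxL (Any-map⁺ (applyUpTo⁺ id {k} ≤-minRows (s≤s k≤N)))
    where
    sized : Subset N → Bool
    sized A = ∣ A ∣ ≡ᵇ k
    A₀ : Σ (Subset N) λ A → ∣ A ∣ ≡ k
    A₀ = ∃-subset-of-size k≤N
    ≤-minRows : B ≤ minRows k
    ≤-minRows = ≤-minL
      (∈-map⁺ (nrows f) (∈-filter⁺ (T? ∘ sized) (∈allSubsets (proj₁ A₀)) (≡⇒≡ᵇ _ _ (proj₂ A₀))))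
      (All-map⁺ (All.map (λ {A} sized-A → bound A (≡ᵇ⇒≡ _ _ sized-A)) (all-filter (T? ∘ sized) (allSubsets N))))

  S≤2^N : S f ≤ 2 ^ N
  S≤2^N = maxL-≤ (All-map⁺ (applyUpTo⁺₂ id (suc N) λ k →
    minL-≤ {xs = map (nrows f) (ofSize k)} (All-map⁺ (All.universal (nrows≤2^N f) _))))

IsSumOfRects : ∀ {N} → (Assignment N → ℕ) → Subset N → ℕ → Set
IsSumOfRects {N} g A r =
  Σ (Fin r → Assignment N → ℕ) λ hs → (∀ i → IsRectangle A (hs i)) × (∀ σ → g σ ≡ sumF (λ i → hs i σ))

orthSum⇒sum : ∀ {N} {g : Assignment N → ℕ} {A r} → IsOrthSumOfRects g A r → IsSumOfRects g A r
orthSum⇒sum (hs , rects , _ , g≡sum) = hs , rects , g≡sum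

b2n*-pos : ∀ c x → 0 < b2n c * x → c ≡ true × 0 < x
b2n*-pos true x h = refl , subst (0 <_) (+-identityʳ x) h

rectangle-cross : ∀ {N} {A : Subset N} {g} → IsRectangle A g →
  ∀ {α β} → 0 < g (merge A α α) → 0 < g (merge A β β) → 0 < g (merge A α β)
rectangle-cross (u , h , _ , _ , g≡uh) {α} {β} gαα>0 gββ>0 =
  subst (0 <_) (sym (trans (g≡uh α β) (cong (λ c → b2n c * h β) uα))) (subst (0 <_) (sym (+-identityʳ (h β))) hβ>0)
  where
  uα : u α ≡ true
  uα = proj₁ (b2n*-pos (u α) (h α) (subst (0 <_) (g≡uh α α) gαα>0))
  hβ>0 : 0 < h β
  hβ>0 = proj₂ (b2n*-pos (u β) (h β) (subst (0 <_) (g≡uh β β) gββ>0))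

fooling-set-bound : ∀ {N A r K} {g : Assignment N → ℕ} → IsSumOfRects g A r → (α : Fin K → Assignment N) →
  (∀ w → 0 < g (merge A (α w) (α w))) → (∀ w w' → 0 < g (merge A (α w) (α w')) → w ≡ w') → K ≤ r
fooling-set-bound {A = A} (hs , rects , g≡sum) α diagonal cross = injective⇒≤ rect-injective
  where
  covering : ∀ w → Σ _ λ c → 0 < hs c (merge A (α w) (α w))
  covering w = sumF-pos⇒pos _ (subst (0 <_) (g≡sum _) (diagonal w))
  rect : ∀ w → Fin _
  rect w = proj₁ (covering w)
  rect-injective : ∀ {w w'} → rect w ≡ rect w' → w ≡ w'
  rect-injective {w} {w'} eq = cross w w' (subst (0 <_) (sym (g≡sum _)) (<-≤-trans hs-cross>0 (≤-sumF _ (rect w))))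
    where
    hs-cross>0 : 0 < hs (rect w) (merge A (α w) (α w'))
    hs-cross>0 = rectangle-cross {A = A} {g = hs (rect w)} (rects (rect w)) (proj₂ (covering w))
      (subst (λ c → 0 < hs c (merge A (α w') (α w'))) (sym eq) (proj₂ (covering w')))

Literal : ℕ → Set
Literal N = Fin N × Bool

satisfies : ∀ {N} → Assignment N → Literal N → Bool
satisfies σ (v , c) = σ v == c

conj : ∀ {N} → List (Literal N) → BoolFun N
conj L σ = allL (satisfies σ) L

module _ {N} (A : Subset N) where

  -- A literal on a variable of A constrains only the row, any other literal only the column.
  rowPart colPart : Assignment N → Literal N → Bool
  rowPart α (v , c) = not (lookup A v) ∨ (α v == c)
  colPart β (v , c) = lookup A v ∨ (β v == c)

  satisfies-merge : ∀ α β l → satisfies (merge A α β) l ≡ rowPart α l ∧ colPart β l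
  satisfies-merge α β (v , c) with lookup A v
  ... | true  = sym (∧-identityʳ _)
  ... | false = refl

  rowPart-merge : ∀ α β l → rowPart (merge A α β) l ≡ rowPart α l
  rowPart-merge α β (v , c) with lookup A v
  ... | true  = refl
  ... | false = refl

  colPart-merge : ∀ α β l → colPart (merge A α β) l ≡ colPart β l
  colPart-merge α β (v , c) with lookup A v
  ... | true  = refl
  ... | false = refl

  conj-isRectangle : ∀ L → IsRectangle A (b2n ∘ conj L)
  conj-isRectangle L =
    (λ α → allL (rowPart α) L) , (λ β → b2n (allL (colPart β) L)) ,
    (λ α β → allL-cong (rowPart-merge α β) L) , (λ α β → cong b2n (allL-cong (colPart-merge α β) L)) ,
    λ α β → trans (cong b2n (trans (allL-cong (satisfies-merge α β) L) (allL-∧ (rowPart α) (colPart β) L)))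
                  (b2n-∧ (allL (rowPart α) L) (allL (colPart β) L))

advance : Bool → (ℕ → Bool) → ℕ → Bool
advance c z = if c then z ∘ suc else z

-- The positions where s holds receive z 0, z 1, … in order; all other positions are false.
spread : ∀ {n} → (Fin n → Bool) → (ℕ → Bool) → Fin n → Bool
spread s z zero    = s zero ∧ z 0
spread s z (suc p) = spread (s ∘ suc) (advance (s zero) z) p

spread-distinguishes : ∀ {n} (s : Fin n → Bool) (z z' : ℕ → Bool) l → l < count s → z l ≢ z' l →
  Σ (Fin n) λ j → s j ≡ true × spread s z j ≢ spread s z' j
spread-distinguishes {suc n} s z z' l l<#s zl≢z'l with s zero in eq
spread-distinguishes {suc n} s z z' zero l<#s zl≢z'l | true =
  zero , eq , subst (λ c → (c ∧ z 0) ≢ (c ∧ z' 0)) (sym eq) zl≢z'l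
spread-distinguishes {suc n} s z z' (suc l) (s≤s l<#s) zl≢z'l | true
  with spread-distinguishes (s ∘ suc) (z ∘ suc) (z' ∘ suc) l l<#s zl≢z'l
... | j , sj , differ = suc j , sj ,
  subst (λ c → spread (s ∘ suc) (advance c z) j ≢ spread (s ∘ suc) (advance c z') j) (sym eq) differ
spread-distinguishes {suc n} s z z' l l<#s zl≢z'l | false
  with spread-distinguishes (s ∘ suc) z z' l l<#s zl≢z'l
... | j , sj , differ = suc j , sj ,
  subst (λ c → spread (s ∘ suc) (advance c z) j ≢ spread (s ∘ suc) (advance c z') j) (sym eq) differ

if-distinct : ∀ {c c'} {x y : Bool} → not (c == c') ≡ true → x ≢ y →
  (if c then x else y) ≢ (if c' then x else y)
if-distinct {true}  {false} _ x≢y = x≢y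
if-distinct {false} {true}  _ x≢y = x≢y ∘ sym

module Layout (m : ℕ) where

  n : ℕ
  n = 2 ^ m

  instance
    n≢0 : NonZero n
    n≢0 = m^n≢0 2 m

  N : ℕ
  N = NVars m

  xVar yVar : Fin n → Fin N
  xVar j = (j ↑ˡ n) ↑ˡ m
  yVar j = (n ↑ʳ j) ↑ˡ m

  iVar : Fin m → Fin N
  iVar k = (n + n) ↑ʳ k

  shiftOf : Assignment N → ℕ
  shiftOf σ = binVal (σ ∘ iVar)

  mod : ℕ → Fin n
  mod k = fromℕ< (m%n<n k n)

  _+ₙ_ : Fin n → ℕ → Fin n
  j +ₙ i = mod (toℕ j + i)

  _-ₙ_ : Fin n → ℕ → Fin n
  p -ₙ i = mod (toℕ p + (n ∸ i))

  mod-toℕ : ∀ j → mod (toℕ j) ≡ j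
  mod-toℕ j = trans (fromℕ<-cong _ _ (m<n⇒m%n≡m (toℕ<n j)) _ _) (fromℕ<-toℕ j (toℕ<n j))

  mod-periodic : ∀ k → mod (n + k) ≡ mod k
  mod-periodic k = fromℕ<-cong _ _ (trans (cong (_% n) (+-comm n k)) ([m+n]%n≡m%n k n)) _ _

  +ₙ-−ₙ : ∀ {i} → i ≤ n → ∀ j → (j +ₙ i) -ₙ i ≡ j
  +ₙ-−ₙ {i} i≤n j = trans (fromℕ<-cong _ _ toℕ≡ _ _) (mod-toℕ j)
    where
    open ≡-Reasoning
    toℕ≡ : (toℕ (j +ₙ i) + (n ∸ i)) % n ≡ toℕ j % n
    toℕ≡ = begin
      (toℕ (j +ₙ i) + (n ∸ i)) % n     ≡⟨ cong (λ z → (z + (n ∸ i)) % n) (toℕ-fromℕ< _) ⟩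
      ((toℕ j + i) % n + (n ∸ i)) % n  ≡⟨ %-distribˡ-+ ((toℕ j + i) % n) (n ∸ i) n ⟩
      ((toℕ j + i) % n % n + (n ∸ i) % n) % n ≡⟨ cong (λ z → (z + (n ∸ i) % n) % n) (m%n%n≡m%n (toℕ j + i) n) ⟩
      ((toℕ j + i) % n + (n ∸ i) % n) % n ≡⟨ sym (%-distribˡ-+ (toℕ j + i) (n ∸ i) n) ⟩
      (toℕ j + i + (n ∸ i)) % n
        ≡⟨ cong (_% n) (trans (+-assoc (toℕ j) i _) (cong (toℕ j +_) (m+[n∸m]≡n i≤n))) ⟩
      (toℕ j + n) % n                   ≡⟨ [m+n]%n≡m%n (toℕ j) n ⟩
      toℕ j % n                         ∎

  SEQ-cong : ∀ {σ τ} → σ ≗ τ → SEQ m σ ≡ SEQ m τ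
  SEQ-cong {σ} {τ} σ≗τ = allF-cong λ j →
    cong₂ _==_ (σ≗τ (xVar j)) (trans (cong (λ s → σ (yVar (j +ₙ s))) (binVal-cong (σ≗τ ∘ iVar))) (σ≗τ _))

  SEQ≡true⁺ : ∀ τ {i} → shiftOf τ ≡ i → (∀ j → τ (xVar j) ≡ τ (yVar (j +ₙ i))) → SEQ m τ ≡ true
  SEQ≡true⁺ τ refl agree = allF⁺ _ (≡⇒== ∘ agree)

  SEQ≡false⁺ : ∀ τ {i} → shiftOf τ ≡ i → (j : Fin n) → τ (xVar j) ≢ τ (yVar (j +ₙ i)) → SEQ m τ ≡ false
  SEQ≡false⁺ τ refl j differ = allF-false⁺ _ j (≢⇒==-false differ)

  SEQ≡false⁻ : ∀ τ → SEQ m τ ≡ false → Σ (Fin n) λ j → τ (yVar (j +ₙ shiftOf τ)) ≡ not (τ (xVar j))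
  SEQ≡false⁻ τ h with allF-false⁻ _ h
  ... | j , differ = j , ==-false⇒≡not differ

module ShiftCount (m : ℕ) (A : Subset (NVars m)) where
  open Layout m

  inX inY : Fin n → Bool
  inX j = lookup A (xVar j)
  inY p = lookup A (yVar p)

  inI : Fin m → Bool
  inI k = lookup A (iVar k)

  split : ℕ → Fin n → Bool
  split i j = not (inX j == inY (j +ₙ i))

  splits : ℕ → ℕ
  splits i = count (split i)

  mismatches : Bool → ℕ
  mismatches c = count (λ p → not (c == inY p))

  sumTo-split : ∀ j → sumTo n (λ i → b2n (split i j)) ≡ mismatches (inX j)
  sumTo-split j = begin
    sumTo n (λ i → G (toℕ j + i)) ≡⟨ sumTo-periodic-shift n G (cong (b2n ∘ mismatch ∘ inY) ∘ mod-periodic) (toℕ j) ⟩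
    sumTo n G                     ≡⟨ sym (sumF-toℕ n G) ⟩
    sumF {n} (G ∘ toℕ)            ≡⟨ sumF-cong (cong (b2n ∘ mismatch ∘ inY) ∘ mod-toℕ) ⟩
    mismatches (inX j)            ∎
    where
    open ≡-Reasoning
    mismatch : Bool → Bool
    mismatch c = not (inX j == c)
    G : ℕ → ℕ
    G k = b2n (mismatch (inY (mod k)))

  sumTo-splits : sumTo n splits ≡ count inX * count (not ∘ inY) + count (not ∘ inX) * count inY
  sumTo-splits = begin
    sumTo n splits                            ≡⟨ sumTo-sumF n (λ i j → b2n (split i j)) ⟩
    sumF (λ j → sumTo n (λ i → b2n (split i j))) ≡⟨ sumF-cong sumTo-split ⟩
    sumF (mismatches ∘ inX)                   ≡⟨ sumF-by-cases inX mismatches ⟩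
    count inX * count (not ∘ inY) + count (not ∘ inX) * mismatches false
      ≡⟨ cong (λ z → count inX * count (not ∘ inY) + count (not ∘ inX) * z)
              (sumF-cong (cong b2n ∘ not-involutive ∘ inY)) ⟩
    count inX * count (not ∘ inY) + count (not ∘ inX) * count inY ∎
    where open ≡-Reasoning

  ∣A∣≡ : ∣ A ∣ ≡ count inX + count inY + count inI
  ∣A∣≡ = trans (∣∣≡count A) (trans (sumF-↑ (n + n) m (b2n ∘ lookup A))
    (cong (_+ count inI) (sumF-↑ n n (λ v → b2n (lookup A (v ↑ˡ m))))))

  ∃-good-shift : ∀ t → ∣ A ∣ ≡ n → n ≡ 16 * t → Σ ℕ λ i → i < n × t ≤ splits i
  ∃-good-shift t ∣A∣≡n n≡16t =
    sumTo-pigeonhole n splits t (m^n>0 2 m)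
      (subst (n * t ≤_) (sym sumTo-splits) (cross-product-bound n≡16t n≤2[a+b] a≤b' b≤a'))
    where
    a+b+ι≡n : count inX + count inY + count inI ≡ n
    a+b+ι≡n = trans (sym ∣A∣≡) ∣A∣≡n
    n≤2[a+b] : n ≤ 2 * (count inX + count inY)
    n≤2[a+b] = covers-half {s = count inX + count inY} {count inI} (sym a+b+ι≡n)
      (≤-trans (*-monoʳ-≤ 2 (count≤ inI)) (2*m≤2^m m))
    a+b≤n : count inX + count inY ≤ n
    a+b≤n = subst (count inX + count inY ≤_) a+b+ι≡n (m≤m+n _ _)
    a≤b' : count inX ≤ count (not ∘ inY)
    a≤b' = +-cancelʳ-≤ (count inY) _ _
      (subst (count inX + count inY ≤_) (trans (sym (count+count-not inY)) (+-comm (count inY) _)) a+b≤n)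
    b≤a' : count inY ≤ count (not ∘ inX)
    b≤a' = +-cancelˡ-≤ (count inX) _ _ (subst (count inX + count inY ≤_) (sym (count+count-not inX)) a+b≤n)

module FoolingSet (m : ℕ) (A : Subset (NVars m)) (i : ℕ) (i<n : i < 2 ^ m) (t : ℕ)
  (t≤splits : t ≤ ShiftCount.splits m A i) where
  open Layout m
  open ShiftCount m A

  word : ℕ → Fin n → Bool
  word w = spread (split i) (bit w)

  -- x = word w, y_(j+i) = x_j and the index bits encode i, so SEQ holds.
  σ : ℕ → Assignment N
  σ w v = [ [ word w , word w ∘ (_-ₙ i) ]′ ∘ splitAt n , bit i ∘ toℕ ]′ (splitAt (n + n) v)

  σ-x : ∀ w j → σ w (xVar j) ≡ word w j
  σ-x w j rewrite splitAt-↑ˡ (n + n) (j ↑ˡ n) m | splitAt-↑ˡ n j n = refl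

  σ-y : ∀ w j → σ w (yVar (j +ₙ i)) ≡ word w j
  σ-y w j rewrite splitAt-↑ˡ (n + n) (n ↑ʳ (j +ₙ i)) m | splitAt-↑ʳ n n (j +ₙ i) =
    cong (word w) (+ₙ-−ₙ (<⇒≤ i<n) j)

  shiftOf-merge : ∀ w w' → shiftOf (merge A (σ w) (σ w')) ≡ i
  shiftOf-merge w w' = trans (binVal-cong index-bit) (binVal-bit m i i<n)
    where
    index-bit : ∀ k → merge A (σ w) (σ w') (iVar k) ≡ bit i (toℕ k)
    index-bit k rewrite splitAt-↑ʳ (n + n) m k with lookup A (iVar k)
    ... | true  = refl
    ... | false = refl

  SEQ-diagonal : ∀ w → SEQ m (merge A (σ w) (σ w)) ≡ true
  SEQ-diagonal w = SEQ≡true⁺ (merge A (σ w) (σ w)) (shiftOf-merge w w) λ j →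
    trans (merge-idem A (σ w) (xVar j)) (trans (σ-x w j) (sym (trans (merge-idem A (σ w) _) (σ-y w j))))

  -- At a split position j where the words of w and w' differ, the merge takes x_j from one word and
  -- y_(j+i) from the other.
  SEQ-cross : ∀ w w' → w < 2 ^ t → w' < 2 ^ t → w ≢ w' → SEQ m (merge A (σ w) (σ w')) ≡ false
  SEQ-cross w w' w<2^t w'<2^t w≢w' with bit-distinct t w w' w<2^t w'<2^t w≢w'
  ... | l , l<t , bits≢ with spread-distinguishes (split i) (bit w) (bit w') l (≤-trans l<t t≤splits) bits≢
  ...   | j , split-j , words≢ = SEQ≡false⁺ (merge A (σ w) (σ w')) (shiftOf-merge w w') j λ x≡y →
    if-distinct split-j words≢ (trans (sym (cong₂ (if inX j then_else_) (σ-x w j) (σ-x w' j)))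
      (trans x≡y (cong₂ (if inY (j +ₙ i) then_else_) (σ-y w j) (σ-y w' j))))

  fooling : Fin (2 ^ t) → Assignment N
  fooling w = σ (toℕ w)

  ≡⊎SEQ-cross-false : ∀ w w' → w ≡ w' ⊎ SEQ m (merge A (fooling w) (fooling w')) ≡ false
  ≡⊎SEQ-cross-false w w' with w ≟ᶠ w'
  ... | yes w≡w' = inj₁ w≡w'
  ... | no  w≢w' = inj₂ (SEQ-cross _ _ (toℕ<n w) (toℕ<n w') (w≢w' ∘ toℕ-injective))

  nrows-negSEQ : 2 ^ t ≤ nrows (negSEQ m) A
  nrows-negSEQ = Rows.nrows-≥ (negSEQ m) (λ σ≗τ → cong not (SEQ-cong σ≗τ)) A fooling distinct
    where
    distinct : ∀ w w' → (∀ β → negSEQ m (merge A (fooling w) β) ≡ negSEQ m (merge A (fooling w') β)) → w ≡ w'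
    distinct w w' same-row with ≡⊎SEQ-cross-false w' w
    ... | inj₁ w'≡w  = sym w'≡w
    ... | inj₂ cross = contradiction
      (trans (cong not (sym (SEQ-diagonal (toℕ w)))) (trans (same-row (fooling w)) (cong not cross)))
      λ ()

  PAch-negSEQ : ∀ r → PAch (negSEQ m) A r → 2 ^ t ≤ r
  PAch-negSEQ r (r₁ , r₂ , r₁+r₂≡r , _ , SEQ-sum) = ≤-trans
    (fooling-set-bound {A = A} (orthSum⇒sum {g = λ σ → b2n (not (negSEQ m σ))} {A} {r₂} SEQ-sum) fooling diagonal cross)
    (subst (r₂ ≤_) r₁+r₂≡r (m≤n+m r₂ r₁))
    where
    diagonal : ∀ w → 0 < b2n (not (negSEQ m (merge A (fooling w) (fooling w))))
    diagonal w = subst (λ c → 0 < b2n (not (not c))) (sym (SEQ-diagonal (toℕ w))) (s≤s z≤n)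
    cross : ∀ w w' → 0 < b2n (not (negSEQ m (merge A (fooling w) (fooling w')))) → w ≡ w'
    cross w w' positive with ≡⊎SEQ-cross-false w w'
    ... | inj₁ w≡w'    = w≡w'
    ... | inj₂ SEQ≡false = contradiction (subst (λ c → 0 < b2n (not (not c))) SEQ≡false positive) λ ()

module Cover (m : ℕ) where
  open Layout m

  -- Satisfied exactly when the shift is i and position j violates SEQ with x_j = c.
  violation : Bool → Fin n → Fin n → List (Literal N)
  violation c i j = (xVar j , c) ∷ (yVar (j +ₙ toℕ i) , not c) ∷ tabulate (λ k → iVar k , bit (toℕ i) (toℕ k))

  violationAt : Fin 2 × Fin (n * n) → List (Literal N)
  violationAt (c , ij) = violation (Inverse.to 2↔Bool c) (proj₁ (remQuot {n} n ij)) (proj₂ (remQuot {n} n ij))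

  violations : Fin (2 * (n * n)) → List (Literal N)
  violations idx = violationAt (remQuot {2} (n * n) idx)

  violations-combine : ∀ c i j → violations (combine c (combine i j)) ≡ violation (Inverse.to 2↔Bool c) i j
  violations-combine c i j = trans (cong violationAt (remQuot-combine c (combine i j)))
    (cong (λ (i′ , j′) → violation (Inverse.to 2↔Bool c) i′ j′) (remQuot-combine i j))

  index-bits⇔shift : ∀ σ (i : Fin n) → allF (λ k → σ (iVar k) == bit (toℕ i) (toℕ k)) ≡ true ⇔ shiftOf σ ≡ toℕ i
  index-bits⇔shift σ i = mk⇔
    (λ h → trans (binVal-cong {c = bit (toℕ i) ∘ toℕ} (λ k → ==⇒≡ (allF⁻ index-bit h k)))
                 (binVal-bit m (toℕ i) (toℕ<n i)))
    (λ shift≡i → allF⁺ index-bit λ k →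
      ≡⇒== (sym (trans (cong (λ s → bit s (toℕ k)) (sym shift≡i)) (bit-binVal (σ ∘ iVar) k))))
    where
    index-bit : Fin m → Bool
    index-bit k = σ (iVar k) == bit (toℕ i) (toℕ k)

  conj-violation⁺ : ∀ σ c i j → σ (xVar j) ≡ c → σ (yVar (j +ₙ toℕ i)) ≡ not c → shiftOf σ ≡ toℕ i →
    conj (violation c i j) σ ≡ true
  conj-violation⁺ σ c i j x≡c y≡¬c shift≡i
    rewrite ≡⇒== x≡c | ≡⇒== y≡¬c | allL-tabulate (satisfies σ) (λ k → iVar k , bit (toℕ i) (toℕ k)) =
    Equivalence.from (index-bits⇔shift σ i) shift≡i

  conj-violation⁻ : ∀ σ c i j → conj (violation c i j) σ ≡ true → SEQ m σ ≡ false
  conj-violation⁻ σ c i j h = SEQ≡false⁺ σ shift≡i j λ x≡y → c≢not-c (trans (sym x≡c) (trans x≡y y≡¬c))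
    where
    x-lit : (σ (xVar j) == c) ≡ true
    x-lit = proj₁ (∧-≡true⁻ {σ (xVar j) == c} h)
    y-lit : (σ (yVar (j +ₙ toℕ i)) == not c) ≡ true
    y-lit = proj₁ (∧-≡true⁻ {σ (yVar (j +ₙ toℕ i)) == not c} (proj₂ (∧-≡true⁻ {σ (xVar j) == c} h)))
    index-lits : allL (satisfies σ) (tabulate (λ k → iVar k , bit (toℕ i) (toℕ k))) ≡ true
    index-lits = proj₂ (∧-≡true⁻ {σ (yVar (j +ₙ toℕ i)) == not c} (proj₂ (∧-≡true⁻ {σ (xVar j) == c} h)))
    x≡c : σ (xVar j) ≡ c
    x≡c = ==⇒≡ x-lit
    y≡¬c : σ (yVar (j +ₙ toℕ i)) ≡ not c
    y≡¬c = ==⇒≡ y-lit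
    shift≡i : shiftOf σ ≡ toℕ i
    shift≡i = Equivalence.to (index-bits⇔shift σ i)
      (trans (sym (allL-tabulate (satisfies σ) (λ k → iVar k , bit (toℕ i) (toℕ k)))) index-lits)
    c≢not-c : ∀ {c} → c ≢ not c
    c≢not-c {true}  ()
    c≢not-c {false} ()

  conj-violationAt⁻ : ∀ σ cij → conj (violationAt cij) σ ≡ true → SEQ m σ ≡ false
  conj-violationAt⁻ σ (c , ij) = conj-violation⁻ σ (Inverse.to 2↔Bool c) (proj₁ (remQuot {n} n ij)) (proj₂ (remQuot {n} n ij))

  SEQ≡false⇔violated : ∀ σ → SEQ m σ ≡ false ⇔ anyF (λ idx → conj (violations idx) σ) ≡ true
  SEQ≡false⇔violated σ = mk⇔ violated λ some →
    let idx , holds = anyF⁻ (λ idx → conj (violations idx) σ) some in conj-violationAt⁻ σ (remQuot {2} (n * n) idx) holds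
    where
    violated : SEQ m σ ≡ false → anyF (λ idx → conj (violations idx) σ) ≡ true
    violated SEQ≡false with SEQ≡false⁻ σ SEQ≡false
    ... | j , y≡¬x = anyF⁺ _ (combine c (combine i j))
      (trans (cong (λ L → conj L σ) (violations-combine c i j)) (conj-violation⁺ σ _ i j x≡c y≡¬c (sym toℕi≡)))
      where
      c : Fin 2
      c = Inverse.from 2↔Bool (σ (xVar j))
      i : Fin n
      i = fromℕ< (binVal< (σ ∘ iVar))
      toℕi≡ : toℕ i ≡ shiftOf σ
      toℕi≡ = toℕ-fromℕ< (binVal< (σ ∘ iVar))
      x≡c : σ (xVar j) ≡ Inverse.to 2↔Bool c
      x≡c = sym (Inverse.strictlyInverseˡ 2↔Bool (σ (xVar j)))
      y≡¬c : σ (yVar (j +ₙ toℕ i)) ≡ not (Inverse.to 2↔Bool c)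
      y≡¬c = trans (cong (λ s → σ (yVar (j +ₙ s))) toℕi≡) (trans y≡¬x (cong not x≡c))

  negSEQ≡anyF : ∀ σ → negSEQ m σ ≡ anyF (λ idx → conj (violations idx) σ)
  negSEQ≡anyF σ = ⇔→≡ {z = true} (mk⇔ (Equivalence.to (SEQ≡false⇔violated σ) ∘ not-injective)
                                      (cong not ∘ Equivalence.from (SEQ≡false⇔violated σ)))

  negSEQ-isORofRects : ∀ A → IsORofRects (negSEQ m) A (2 * (n * n))
  negSEQ-isORofRects A = (λ idx → conj (violations idx)) , (λ idx → conj-isRectangle A (violations idx)) , negSEQ≡anyF

2^-≤-^ : ∀ a {t x} → 2 ^ t ≤ x → 2 ^ (a * t) ≤ x ^ a
2^-≤-^ a {t} 2^t≤x = subst (_≤ _) (trans (^-*-assoc 2 t a) (cong (2 ^_) (*-comm t a))) (^-monoˡ-≤ a 2^t≤x)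

n≡16*2^[m∸4] : ∀ {m} → 4 ≤ m → 2 ^ m ≡ 16 * 2 ^ (m ∸ 4)
n≡16*2^[m∸4] {m} 4≤m = trans (cong (2 ^_) (sym (m+[n∸m]≡n 4≤m))) (^-distribˡ-+-* 2 4 (m ∸ 4))

n≤NVars : ∀ m → 2 ^ m ≤ NVars m
n≤NVars m = ≤-trans (m≤m+n (2 ^ m) (2 ^ m)) (m≤m+n _ m)

NVars≤3n : ∀ m → NVars m ≤ 3 * 2 ^ m
NVars≤3n m = ≤-trans (+-monoʳ-≤ (2 ^ m + 2 ^ m) (≤-trans (m≤n*m m 2) (2*m≤2^m m))) (≤-reflexive (thrice (2 ^ m)))
  where
  thrice : ∀ x → x + x + x ≡ 3 * x
  thrice = solve-∀

s≤s*s : ∀ s → s ≤ s * s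
s≤s*s zero    = z≤n
s≤s*s (suc s) = m≤m*n (suc s) (suc s)

nrows-negSEQ-≥ : ∀ m (A : Subset (NVars m)) t → ∣ A ∣ ≡ 2 ^ m → 2 ^ m ≡ 16 * t → 2 ^ t ≤ nrows (negSEQ m) A
nrows-negSEQ-≥ m A t ∣A∣≡n n≡16t with ShiftCount.∃-good-shift m A t ∣A∣≡n n≡16t
... | i , i<n , t≤splits = FoolingSet.nrows-negSEQ m A i i<n t t≤splits

PAch-negSEQ-≥ : ∀ m (A : Subset (NVars m)) t → ∣ A ∣ ≡ 2 ^ m → 2 ^ m ≡ 16 * t →
  ∀ r → PAch (negSEQ m) A r → 2 ^ t ≤ r
PAch-negSEQ-≥ m A t ∣A∣≡n n≡16t with ShiftCount.∃-good-shift m A t ∣A∣≡n n≡16t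
... | i , i<n , t≤splits = FoolingSet.PAch-negSEQ m A i i<n t t≤splits

S-negSEQ-≥ : ∀ m → 4 ≤ m → 2 ^ (2 ^ m) ≤ S (negSEQ m) ^ 16
S-negSEQ-≥ m 4≤m = subst (λ e → 2 ^ e ≤ S (negSEQ m) ^ 16) (sym (n≡16*2^[m∸4] 4≤m))
  (2^-≤-^ 16 {2 ^ (m ∸ 4)} (≤-S (negSEQ m) (n≤NVars m) λ A ∣A∣≡n →
    nrows-negSEQ-≥ m A (2 ^ (m ∸ 4)) ∣A∣≡n (n≡16*2^[m∸4] 4≤m)))

S-negSEQ-≤ : ∀ m → S (negSEQ m) ≤ 2 ^ (3 * 2 ^ m)
S-negSEQ-≤ m = ≤-trans (S≤2^N (negSEQ m)) (^-monoʳ-≤ 2 (NVars≤3n m))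

-- The fooling set even gives 2^(n/16); the stated 2^(√n) form follows from s ≤ s * s ≤ n.
P-negSEQ : ∀ m → 4 ≤ m → MaxMinSatisfies (PAch (negSEQ m)) (λ r → ∀ s → s * s ≤ 2 ^ m → 2 ^ s ≤ r ^ 16)
P-negSEQ m 4≤m = 2 ^ m , n≤NVars m , λ A ∣A∣≡n r achieved s s*s≤n →
  ≤-trans (^-monoʳ-≤ 2 (≤-trans (s≤s*s s) (subst (s * s ≤_) (n≡16*2^[m∸4] 4≤m) s*s≤n)))
          (2^-≤-^ 16 {2 ^ (m ∸ 4)} (PAch-negSEQ-≥ m A (2 ^ (m ∸ 4)) ∣A∣≡n (n≡16*2^[m∸4] 4≤m) r achieved))

C-negSEQ : ∀ m → MaxMinAtMost (CAch (negSEQ m)) (2 * (2 ^ m * 2 ^ m))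
C-negSEQ m k k≤N with ∃-subset-of-size k≤N
... | A , ∣A∣≡k = A , ∣A∣≡k , 2 * (2 ^ m * 2 ^ m) , ≤-refl , Cover.negSEQ-isORofRects m A

proposition3p11 : (Σ ℕ λ a → Σ ℕ λ b → Σ ℕ λ m₀ → ∀ m → m₀ ≤ m →
    (2 ^ (2 ^ m) ≤ S (negSEQ m) ^ a) × (S (negSEQ m) ≤ 2 ^ (b * 2 ^ m)))
    × (Σ ℕ λ a → Σ ℕ λ m₀ → ∀ m → m₀ ≤ m →
    MaxMinSatisfies (PAch (negSEQ m)) (λ r → ∀ s → s * s ≤ 2 ^ m → 2 ^ s ≤ r ^ a))
    × (Σ ℕ λ c → Σ ℕ λ m₀ → ∀ m → m₀ ≤ m →
    MaxMinAtMost (CAch (negSEQ m)) (c * (2 ^ m * 2 ^ m)))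
proposition3p11 =
    (16 , 3 , 4 , λ m 4≤m → S-negSEQ-≥ m 4≤m , S-negSEQ-≤ m)
  , (16 , 4 , P-negSEQ)
  , (2 , 0 , λ m _ → C-negSEQ m)
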